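{- For any $n\geq 1$, $\mathbb{W}^1_n=1 \cdot \mathbb{W}^1_{n-1} \circ \mathbb{Z}_n$ is a $1$-Gray code for $\mathcal{W}^1_n$ such that $\mathrm{first}(\mathbb{W}^1_n)=1^n$, $\mathrm{last}(\mathbb{W}^1_n)=(001)^\star$, and where $\mathbb{W}^1_0$ is a list containing only the empty word.
   Context: A binary word is $1$-decreasing if each of its maximal factors of the form $0^a1^b$ with $a>0$ satisfies $a>b$. $\mathcal{W}^1_n$ is the set of $1$-decreasing words of length $n$, and $\mathcal{Z}_n$ its subset of words starting with $0$, so that $\mathcal{W}^1_n=\mathcal{Z}_n\cup 1\cdot\mathcal{W}^1_{n-1}$. For each $n\ge 0$, $\mathbb{Z}_n$ is a $1$-Gray code for $\mathcal{Z}_n$ (such codes exist) whose first element is $0(001)^\star$ and whose last element is $(001)^\star$. A $1$-Gray code for a set of words is an ordered list of all its words such that any two consecutive words have Hamming distance at most one. For lists, $\circ$ is concatenation, $w\cdot\mathbb{L}$ prepends the word $w$ to every word of $\mathbb{L}$, and $\mathrm{first}(\mathbb{L})$, $\mathrm{last}(\mathbb{L})$ are the first and last elements of $\mathbb{L}$. For a word $v$, $v^\star$ means $v$ repeated as many times as needed to reach length $n$, trimming extra symbols at the end. -}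

module Defs where

open import Data.Bool using (Bool; true; false; if_then_else_; _xor_)
open import Data.Nat using (ℕ; zero; suc; _+_; _≤_; _<_)
open import Data.List using (List; []; _∷_; _++_; map; replicate; take; concat; length; head; last)
open import Data.List.Membership.Propositional using (_∈_)
open import Data.List.Relation.Unary.Unique.Propositional using (Unique)
open import Data.List.Relation.Unary.Linked using (Linked)
open import Data.Maybe using (Maybe; just)
open import Data.Product using (_×_)
open import Relation.Binary.PropositionalEquality using (_≡_)
open import Relation.Nullary using (¬_)

-- Binary words: 0 = false, 1 = true.
Word : Set
Word = List Bool

-- Hamming distance (only meaningful on words of equal length;
-- extra symbols count as differences).
hamming : Word → Word → ℕ
hamming []       ys       = length ys
hamming (x ∷ xs) []       = length (x ∷ xs)
hamming (x ∷ xs) (y ∷ ys) = (if x xor y then 1 else 0) + hamming xs ys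

NotEndsIn0 : Word → Set
NotEndsIn0 u = ¬ (last u ≡ just false)

NotStartsWith1 : Word → Set
NotStartsWith1 v = ¬ (head v ≡ just true)

-- 1-decreasing: every maximal factor 0^a 1^b with a > 0 satisfies a > b.
OneDecreasing : Word → Set
OneDecreasing w = ∀ (u v : Word) (a b : ℕ) → 0 < a →
  w ≡ u ++ replicate a false ++ replicate b true ++ v →
  NotEndsIn0 u → NotStartsWith1 v → b < a

InW : ℕ → Word → Set
InW n w = (length w ≡ n) × OneDecreasing w

InZ : ℕ → Word → Set
InZ n w = InW n w × (head w ≡ just false)

record IsGrayCode (P : Word → Set) (L : List Word) : Set where
  field
    sound    : ∀ w → w ∈ L → P w
    complete : ∀ w → P w → w ∈ L
    unique   : Unique L
    adjacent : Linked (λ u v → hamming u v ≤ 1) L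

-- v^⋆ of length n (v nonempty)
star : Word → ℕ → Word
star v n = take n (concat (replicate n v))

w001 : Word
w001 = false ∷ false ∷ true ∷ []

s001 : ℕ → Word
s001 n = star w001 n

zs001 : ℕ → Word
zs001 n = take n (false ∷ s001 n)

W : (ℕ → List Word) → ℕ → List Word
W Z zero    = [] ∷ []
W Z (suc n) = map (true ∷_) (W Z n) ++ Z (suc n)

-- Words of 𝒲¹ₙ starting with 1 are exactly 1·𝒲¹ₙ₋₁, since a leading 1 belongs to
-- no factor 0^a 1^b with a > 0; the others form 𝒵ₙ. The only new adjacency is at the junction, between
-- 1·(001)^⋆ of length n-1 and first(ℤₙ) = 0(001)^⋆: since (001)^⋆ of length n-1
-- is the prefix of (001)^⋆ of length n, these differ in the first letter only.
module Submission where

open import Defs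
open import Data.Bool using (Bool; true; false)
import Data.Empty
open import Data.List using (List; []; _∷_; _++_; map; replicate; take; concat; length; head; last)
open import Data.List.Membership.Propositional using (_∈_)
open import Data.List.Membership.Propositional.Properties using (∈-map⁻; ∈-map⁺; ∈-++⁻; ∈-++⁺ˡ; ∈-++⁺ʳ)
open import Data.List.Properties using (∷-injectiveʳ; ++-assoc; ++-identityʳ; length-++; last-map; take-take)
open import Data.List.Relation.Unary.AllPairs using ([]; _∷_)
open import Data.List.Relation.Unary.All using ([])
open import Data.List.Relation.Unary.Any using (here)
open import Data.List.Relation.Unary.Linked using ([-])
import Data.List.Relation.Unary.Linked as Linked
import Data.List.Relation.Unary.Linked.Properties as Linked
import Data.List.Relation.Unary.Unique.Propositional.Properties as Unique
import Data.Maybe as Maybe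
open import Data.Maybe using (just)
open import Data.Maybe.Relation.Binary.Connected using (Connected; just)
open import Data.Nat using (ℕ; zero; suc; _≤_; _⊓_; z≤n; s≤s)
open import Data.Nat.Properties using (≤-refl; ≤-trans; suc-injective; m≤n+m; n≤1+n; m≤n⇒m⊓n≡m)
open import Data.Product using (_×_; _,_; proj₁; proj₂)
import Data.Sum as Sum
open import Data.Sum using (inj₁; inj₂)
open import Level using (0ℓ)
open import Relation.Binary.PropositionalEquality using (_≡_; refl; cong; sym; trans; subst₂; module ≡-Reasoning)
open import Relation.Unary using (Pred; _⊆_; _≐_; _∪_; _⊥_; ｛_｝)

private
  variable
    A B : Set
    n : ℕ

head-map-++ : ∀ (f : A → B) {x} xs ys → head xs ≡ just x → head (map f xs ++ ys) ≡ just (f x)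
head-map-++ f (_ ∷ _) ys refl = refl

last-++-just : ∀ (xs : List A) {y} ys → last ys ≡ just y → last (xs ++ ys) ≡ just y
last-++-just []            ys eq = eq
last-++-just (x ∷ [])      (_ ∷ _) eq = eq
last-++-just (x ∷ x′ ∷ xs) ys eq = last-++-just (x′ ∷ xs) ys eq

take-++-≤ : ∀ k (xs ys : List A) → k ≤ length xs → take k (xs ++ ys) ≡ take k xs
take-++-≤ zero    xs       ys _         = refl
take-++-≤ (suc k) (x ∷ xs) ys (s≤s k≤) = cong (x ∷_) (take-++-≤ k xs ys k≤)

concat-replicate-comm : ∀ k (v : List A) → v ++ concat (replicate k v) ≡ concat (replicate k v) ++ v
concat-replicate-comm zero    v = ++-identityʳ v
concat-replicate-comm (suc k) v =
  trans (cong (v ++_) (concat-replicate-comm k v)) (sym (++-assoc v (concat (replicate k v)) v))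

≤-length-concat-replicate : ∀ k (x : A) v → k ≤ length (concat (replicate k (x ∷ v)))
≤-length-concat-replicate zero    x v = z≤n
≤-length-concat-replicate (suc k) x v rewrite length-++ v {concat (replicate k (x ∷ v))} =
  s≤s (≤-trans (≤-length-concat-replicate k x v) (m≤n+m _ (length v)))

-- The first n letters of (001)^k do not depend on k ≥ n, as (001)^n already has length ≥ n.
take-s001-suc : ∀ n → take n (s001 (suc n)) ≡ s001 n
take-s001-suc n = begin
  take n (take (suc n) (C (suc n)))  ≡⟨ take-take n (suc n) (C (suc n)) ⟩
  take (n ⊓ suc n) (C (suc n))       ≡⟨ cong (λ k → take k (C (suc n))) (m≤n⇒m⊓n≡m (n≤1+n n)) ⟩
  take n (w001 ++ C n)               ≡⟨ cong (take n) (concat-replicate-comm n w001) ⟩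
  take n (C n ++ w001)               ≡⟨ take-++-≤ n (C n) w001 (≤-length-concat-replicate n false _) ⟩
  s001 n                             ∎
  where
  open ≡-Reasoning
  C : ℕ → Word
  C k = concat (replicate k w001)

zs001-suc : ∀ n → zs001 (suc n) ≡ false ∷ s001 n
zs001-suc n = cong (false ∷_) (take-s001-suc n)

Adjacent : Word → Word → Set
Adjacent u v = hamming u v ≤ 1

hamming-∷ : ∀ b u v → hamming (b ∷ u) (b ∷ v) ≡ hamming u v
hamming-∷ true  u v = refl
hamming-∷ false u v = refl

hamming-refl : ∀ w → hamming w w ≡ 0
hamming-refl []      = refl
hamming-refl (b ∷ w) = trans (hamming-∷ b w w) (hamming-refl w)

adjacent-flip-head : ∀ w → Adjacent (true ∷ w) (false ∷ w)
adjacent-flip-head w rewrite hamming-refl w = ≤-refl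

oneDecreasing-[] : OneDecreasing []
oneDecreasing-[] []      _ (suc _) _ _ ()
oneDecreasing-[] (_ ∷ _) _ (suc _) _ _ ()

oneDecreasing-1∷⁺ : ∀ {w} → OneDecreasing w → OneDecreasing (true ∷ w)
oneDecreasing-1∷⁺ od []       v (suc a) b _   ()
oneDecreasing-1∷⁺ od (c ∷ u) v a       b a>0 eq u≢⋯0 =
  od u v a b a>0 (∷-injectiveʳ eq) (notEndsIn0-tail u u≢⋯0)
  where
  notEndsIn0-tail : ∀ u → NotEndsIn0 (c ∷ u) → NotEndsIn0 u
  notEndsIn0-tail []      _ ()
  notEndsIn0-tail (_ ∷ _) p = p

oneDecreasing-1∷⁻ : ∀ {w} → OneDecreasing (true ∷ w) → OneDecreasing w
oneDecreasing-1∷⁻ od u v a b a>0 eq u≢⋯0 =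
  od (true ∷ u) v a b a>0 (cong (true ∷_) eq) (notEndsIn0-1∷ u u≢⋯0)
  where
  notEndsIn0-1∷ : ∀ u → NotEndsIn0 u → NotEndsIn0 (true ∷ u)
  notEndsIn0-1∷ []      _ ()
  notEndsIn0-1∷ (_ ∷ _) p = p

infixr 5 _∷ᴾ_
_∷ᴾ_ : Bool → Pred Word 0ℓ → Pred Word 0ℓ
(b ∷ᴾ P) []      = Data.Empty.⊥
(b ∷ᴾ P) (c ∷ w) = c ≡ b × P w

InW-zero : ｛ [] ｝ ≐ InW 0
InW-zero = (λ { refl → refl , oneDecreasing-[] }) , λ { {[]} _ → refl }

InW-suc : (true ∷ᴾ InW n) ∪ InZ (suc n) ≐ InW (suc n)
InW-suc {n} = join , split
  where
  split : InW (suc n) ⊆ (true ∷ᴾ InW n) ∪ InZ (suc n)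
  split {true  ∷ w} (len , od) = inj₁ (refl , suc-injective len , oneDecreasing-1∷⁻ od)
  split {false ∷ w} w∈W        = inj₂ (w∈W , refl)
  join : (true ∷ᴾ InW n) ∪ InZ (suc n) ⊆ InW (suc n)
  join {true ∷ w} (inj₁ (refl , len , od)) = cong suc len , oneDecreasing-1∷⁺ od
  join            (inj₂ (w∈W , _))         = w∈W

1∷ᴾ-⊥-InZ : ∀ P → (true ∷ᴾ P) ⊥ (InZ n)
1∷ᴾ-⊥-InZ P {true ∷ _} (_ , (_ , ()))

module _ {P Q : Pred Word 0ℓ} where
  open IsGrayCode

  isGrayCode-resp-≐ : ∀ {L} → P ≐ Q → IsGrayCode P L → IsGrayCode Q L
  isGrayCode-resp-≐ (P⊆Q , Q⊆P) gc = record
    { sound    = λ w w∈L → P⊆Q (sound gc w w∈L)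
    ; complete = λ w Qw → complete gc w (Q⊆P Qw)
    ; unique   = unique gc
    ; adjacent = adjacent gc
    }

  isGrayCode-++ : ∀ {L M} → IsGrayCode P L → IsGrayCode Q M → P ⊥ Q →
                  Connected Adjacent (last L) (head M) → IsGrayCode (P ∪ Q) (L ++ M)
  isGrayCode-++ {L} {M} gcL gcM P⊥Q junction = record
    { sound    = λ w w∈ → Sum.map (sound gcL w) (sound gcM w) (∈-++⁻ L w∈)
    ; complete = λ { w (inj₁ Pw) → ∈-++⁺ˡ (complete gcL w Pw)
                   ; w (inj₂ Qw) → ∈-++⁺ʳ L (complete gcM w Qw) }
    ; unique   = Unique.++⁺ (unique gcL) (unique gcM)
                   (λ { (w∈L , w∈M) → P⊥Q (sound gcL _ w∈L , sound gcM _ w∈M) })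
    ; adjacent = Linked.++⁺ (adjacent gcL) junction (adjacent gcM)
    }

isGrayCode-[_] : ∀ w → IsGrayCode ｛ w ｝ (w ∷ [])
isGrayCode-[ w ] = record
  { sound    = λ { _ (here refl) → refl }
  ; complete = λ { _ refl → here refl }
  ; unique   = [] ∷ []
  ; adjacent = [-]
  }

isGrayCode-map-∷ : ∀ b {P L} → IsGrayCode P L → IsGrayCode (b ∷ᴾ P) (map (b ∷_) L)
isGrayCode-map-∷ b {P} {L} gc = record
  { sound    = sound′
  ; complete = complete′
  ; unique   = Unique.map⁺ ∷-injectiveʳ (unique gc)
  ; adjacent = Linked.map⁺ (Linked.map {S = λ u v → Adjacent (b ∷ u) (b ∷ v)}
                                       (λ {u} {v} → adjacent-∷ {u} {v}) (adjacent gc))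
  }
  where
  open IsGrayCode
  sound′ : ∀ w → w ∈ map (b ∷_) L → (b ∷ᴾ P) w
  sound′ w w∈ with ∈-map⁻ (b ∷_) w∈
  ... | u , u∈L , refl = refl , sound gc u u∈L
  complete′ : ∀ w → (b ∷ᴾ P) w → w ∈ map (b ∷_) L
  complete′ (_ ∷ u) (refl , Pu) = ∈-map⁺ (b ∷_) (complete gc u Pu)
  adjacent-∷ : ∀ {u v} → Adjacent u v → Adjacent (b ∷ u) (b ∷ v)
  adjacent-∷ {u} {v} uv rewrite hamming-∷ b u v = uv

module _ (Z : ℕ → List Word) where

  head-W : ∀ n → head (W Z n) ≡ just (replicate n true)
  head-W zero    = refl
  head-W (suc n) = head-map-++ (true ∷_) (W Z n) (Z (suc n)) (head-W n)

  last-W : (∀ n → last (Z (suc n)) ≡ just (s001 (suc n))) →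
           ∀ n → last (W Z n) ≡ just (s001 n)
  last-W last-Z zero    = refl
  last-W last-Z (suc n) = last-++-just (map (true ∷_) (W Z n)) (Z (suc n)) (last-Z n)

  isGrayCode-W : (∀ n → IsGrayCode (InZ (suc n)) (Z (suc n))) →
                 (∀ n → head (Z (suc n)) ≡ just (zs001 (suc n))) →
                 (∀ n → last (Z (suc n)) ≡ just (s001 (suc n))) →
                 ∀ n → IsGrayCode (InW n) (W Z n)
  isGrayCode-W gc-Z head-Z last-Z zero    =
    isGrayCode-resp-≐ InW-zero isGrayCode-[ [] ]
  isGrayCode-W gc-Z head-Z last-Z (suc n) =
    isGrayCode-resp-≐ InW-suc
      (isGrayCode-++ (isGrayCode-map-∷ true (isGrayCode-W gc-Z head-Z last-Z n)) (gc-Z n)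
                     (1∷ᴾ-⊥-InZ (InW n)) junction)
    where
    junction : Connected Adjacent (last (map (true ∷_) (W Z n))) (head (Z (suc n)))
    junction = subst₂ (Connected Adjacent) (sym last-1∷W) (sym head-Z′) (just (adjacent-flip-head (s001 n)))
      where
      last-1∷W : last (map (true ∷_) (W Z n)) ≡ just (true ∷ s001 n)
      last-1∷W = trans (last-map (true ∷_) (W Z n)) (cong (Maybe.map (true ∷_)) (last-W last-Z n))
      head-Z′ : head (Z (suc n)) ≡ just (false ∷ s001 n)
      head-Z′ = trans (head-Z n) (cong just (zs001-suc n))

theorem4 : (Z : ℕ → List Word) →
    (∀ n → 1 ≤ n → IsGrayCode (InZ n) (Z n) × head (Z n) ≡ just (zs001 n) × last (Z n) ≡ just (s001 n)) →
    ∀ n → 1 ≤ n →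
    IsGrayCode (InW n) (W Z n) × head (W Z n) ≡ just (replicate n true) × last (W Z n) ≡ just (s001 n)
theorem4 Z hyp n _ = isGrayCode-W Z gc-Z head-Z last-Z n , head-W Z n , last-W Z last-Z n
  where
  gc-Z : ∀ k → IsGrayCode (InZ (suc k)) (Z (suc k))
  gc-Z k = proj₁ (hyp (suc k) (s≤s z≤n))
  head-Z : ∀ k → head (Z (suc k)) ≡ just (zs001 (suc k))
  head-Z k = proj₁ (proj₂ (hyp (suc k) (s≤s z≤n)))
  last-Z : ∀ k → last (Z (suc k)) ≡ just (s001 (suc k))
  last-Z k = proj₂ (proj₂ (hyp (suc k) (s≤s z≤n)))
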